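{- The only connected vertex-transitive graph whose local graph is isomorphic to $\overline{P_5}$ is $\overline{C_8}$.
   Context: All graphs are finite and simple. $\overline{P_5}$ is the complement of the path on 5 vertices, i.e. the graph on $\{1,2,3,4,5\}$ with edges $13,14,15,24,25,35$ (a 5-vertex graph with exactly one triangle and no universal vertex); $\overline{C_8}$ is the complement of the 8-cycle. The local graph of $\Gamma$ at $v$ is the subgraph induced by the neighbours of $v$. A graph is vertex-transitive if its automorphism group acts transitively on its vertices. -}

module Defs where

open import Data.Nat using (ℕ; zero; suc; _%_; _≡ᵇ_)
open import Data.Fin using (Fin; toℕ)
open import Data.Bool using (Bool; true; false; not; _∧_; _∨_)
open import Data.Product using (Σ; ∃; _×_; _,_)
open import Relation.Binary.PropositionalEquality using (_≡_)
open import Function.Bundles using (_↔_; Inverse)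

Graph : Set → Set
Graph V = V → V → Bool

IsSimple : {V : Set} → Graph V → Set
IsSimple {V} G = (∀ (x y : V) → G x y ≡ G y x) × (∀ (x : V) → G x x ≡ false)

_≅_ : {V W : Set} → Graph V → Graph W → Set
_≅_ {V} {W} G H =
  Σ (V ↔ W) λ f → ∀ (x y : V) → H (Inverse.to f x) (Inverse.to f y) ≡ G x y

Automorphism : {V : Set} → Graph V → Set
Automorphism G = G ≅ G

VertexTransitive : {V : Set} → Graph V → Set
VertexTransitive {V} G =
  ∀ (u v : V) → Σ (Automorphism G) λ σ → Inverse.to (Data.Product.proj₁ σ) u ≡ v

data Walk {V : Set} (G : Graph V) : V → V → Set where
  here  : ∀ {u} → Walk G u u
  step  : ∀ {u w v} → G u w ≡ true → Walk G w v → Walk G u v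

Connected : {V : Set} → Graph V → Set
Connected {V} G = V × (∀ (u v : V) → Walk G u v)

LocalGraph : {V : Set} → (G : Graph V) → (v : V) → Graph (Σ V λ w → G v w ≡ true)
LocalGraph G v (x , _) (y , _) = G x y

-- complement of P_5, on vertices 0..4 (paper's 1..5), edges 13,14,15,24,25,35
P5bar-ℕ : ℕ → ℕ → Bool
P5bar-ℕ 0 2 = true
P5bar-ℕ 0 3 = true
P5bar-ℕ 0 4 = true
P5bar-ℕ 1 3 = true
P5bar-ℕ 1 4 = true
P5bar-ℕ 2 4 = true
P5bar-ℕ 2 0 = true
P5bar-ℕ 3 0 = true
P5bar-ℕ 4 0 = true
P5bar-ℕ 3 1 = true
P5bar-ℕ 4 1 = true
P5bar-ℕ 4 2 = true
P5bar-ℕ _ _ = false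

P5bar : Graph (Fin 5)
P5bar i j = P5bar-ℕ (toℕ i) (toℕ j)

C8 : Graph (Fin 8)
C8 i j = ((suc (toℕ i) % 8) ≡ᵇ toℕ j) ∨ ((suc (toℕ j) % 8) ≡ᵇ toℕ i)

C8bar : Graph (Fin 8)
C8bar i j = not (toℕ i ≡ᵇ toℕ j) ∧ not (C8 i j)

-- Fix v and list its neighbours as x₀, …, x₄, numbered so that xᵢ ~ xⱼ iff |i − j| ≥ 2.
-- In the local graphs at x₀ and at x₄ exactly one vertex lies outside the closed
-- neighbourhood of v; call these t₀ and t₄. Reading off the local graphs at x₁, x₂, x₃
-- shows that t₀ ~ x₀, x₁, x₂, x₃, that t₄ ~ x₁, x₂, x₃, x₄, and that t₀ ~ t₄, so
-- v, x₀, …, x₄, t₀, t₄ span an induced copy of C̄₈. As C̄₈ is 5-regular and twin-free while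
-- every vertex of Γ has exactly five neighbours, this copy is closed under taking
-- neighbours; by connectivity it is the whole of Γ.

module Submission where

open import Defs
open import Axiom.UniquenessOfIdentityProofs using (module Decidable⇒UIP)
open import Data.Bool using (true; false)
open import Data.Bool.Properties using (¬-not) renaming (_≟_ to _≟ᵇ_)
open import Data.Empty using (⊥; ⊥-elim)
open import Data.Fin using (Fin; zero; suc; #_; toℕ; _↑ˡ_; splitAt; punchOut)
open import Data.Fin.Properties using (all?; any?; _≟_; injective⇒≤; punchOut-injective)
open import Data.Nat using (ℕ; suc; _+_)
open import Data.Nat.DivMod using (_mod_)
open import Data.Nat.Properties using (1+n≰n)
open import Data.Product using (∃; _×_; _,_; proj₁; proj₂)
import Data.Product as Product
open import Data.Vec using ([]; _∷_; lookup)
open import Data.Sum using (_⊎_; inj₁; inj₂; [_,_]′)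
import Data.Sum as Sum
open import Function using (_∘_)
open import Function.Bundles using (Inverse; mk↔ₛ′)
open import Function.Definitions using (Injective)
open import Relation.Binary.PropositionalEquality
open import Relation.Nullary using (¬_; yes; no; contradiction)
open import Relation.Nullary.Decidable using (from-yes; _→-dec_; _×-dec_; _⊎-dec_; ¬?)

injective⇒surjective : ∀ {k} {f : Fin k → Fin k} → Injective _≡_ _≡_ f → ∀ y → ∃ λ i → f i ≡ y
injective⇒surjective {suc k} {f} f-injective y with any? (λ i → f i ≟ y)
... | yes hit = hit
... | no miss = contradiction (injective⇒≤ punched-injective) 1+n≰n
  where
    avoids : ∀ i → ¬ y ≡ f i
    avoids i e = miss (i , sym e)

    punched-injective : Injective _≡_ _≡_ (λ i → punchOut (avoids i))
    punched-injective e = f-injective (punchOut-injective (avoids _) (avoids _) e)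

record Chart {V : Set} (Γ : Graph V) {k : ℕ} (H : Graph (Fin k)) (u : V) : Set where
  field
    point : Fin k → V
    point-adjacent : ∀ i → Γ u (point i) ≡ true
    point-pattern : ∀ i j → Γ (point i) (point j) ≡ H i j
    point-injective : Injective _≡_ _≡_ point
    covers : ∀ y → Γ u y ≡ true → ∃ λ i → point i ≡ y

  ↓_ : ∀ {i j b} → Γ (point i) (point j) ≡ b → H i j ≡ b
  ↓ h = trans (sym (point-pattern _ _)) h

  ↑_ : ∀ {i j b} → H i j ≡ b → Γ (point i) (point j) ≡ b
  ↑ h = trans (point-pattern _ _) h

  common-neighbour : ∀ i {y} → Γ (point i) y ≡ true → Γ u y ≡ true → ∃ λ j → point j ≡ y × H i j ≡ true
  common-neighbour i h p with covers _ p
  ... | j , refl = j , refl , ↓ h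

  neighbours-exhausted : (ys : Fin k → V) → Injective _≡_ _≡_ ys → (∀ l → Γ u (ys l) ≡ true)
    → ∀ {y} → Γ u y ≡ true → ∃ λ l → ys l ≡ y
  neighbours-exhausted ys ys-injective ys-adjacent {y} p = proj₁ hit , (begin
    ys (proj₁ hit)               ≡⟨ sym (locates (proj₁ hit)) ⟩
    point (position (proj₁ hit)) ≡⟨ cong point (proj₂ hit) ⟩
    point (proj₁ found)          ≡⟨ proj₂ found ⟩
    y                            ∎)
    where
      open ≡-Reasoning

      position : Fin k → Fin k
      position l = proj₁ (covers _ (ys-adjacent l))

      locates : ∀ l → point (position l) ≡ ys l
      locates l = proj₂ (covers _ (ys-adjacent l))

      position-injective : Injective _≡_ _≡_ position
      position-injective {l} {l′} e = ys-injective (trans (sym (locates l)) (trans (cong point e) (locates l′)))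

      found : ∃ λ i → point i ≡ y
      found = covers y p

      hit : ∃ λ l → position l ≡ proj₁ found
      hit = injective⇒surjective position-injective (proj₁ found)

chart : ∀ {V} {Γ : Graph V} {k} {H : Graph (Fin k)} {u} → LocalGraph Γ u ≅ H → Chart Γ H u
chart {Γ = Γ} {H = H} (F , F-preserves) = record
  { point = λ i → proj₁ (from i)
  ; point-adjacent = λ i → proj₂ (from i)
  ; point-pattern = λ i j → trans (sym (F-preserves (from i) (from j))) (cong₂ H (strictlyInverseˡ i) (strictlyInverseˡ j))
  ; point-injective = λ {i} {j} e → trans (sym (strictlyInverseˡ i)) (trans (cong to (same-neighbour e)) (strictlyInverseˡ j))
  ; covers = λ y p → to (y , p) , cong proj₁ (strictlyInverseʳ (y , p))
  }
  where
    open Inverse F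

    same-neighbour : ∀ {a b} → proj₁ a ≡ proj₁ b → a ≡ b
    same-neighbour {w , p} {.w , q} refl = cong (w ,_) (Decidable⇒UIP.≡-irrelevant _≟ᵇ_ p q)

TwinFree : ∀ {m} → Graph (Fin m) → Set
TwinFree Δ = ∀ i j → (∀ l → Δ l i ≡ Δ l j) → i ≡ j

module _ {V : Set} {Γ : Graph V} {k : ℕ} {H : Graph (Fin k)} (charts : ∀ u → Chart Γ H u)
         {m : ℕ} {Δ : Graph (Fin (suc m))} (twin-free : TwinFree Δ)
         (ν : Fin (suc m) → Fin k → Fin (suc m)) (ν-adjacent : ∀ i l → Δ i (ν i l) ≡ true)
         (ν-injective : ∀ i → Injective _≡_ _≡_ (ν i))
         (g : Fin (suc m) → V) (g-induced : ∀ i j → Γ (g i) (g j) ≡ Δ i j) where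

  g-injective : Injective _≡_ _≡_ g
  g-injective {i} {j} e = twin-free i j λ l → trans (sym (g-induced l i)) (trans (cong (Γ (g l)) e) (g-induced l j))

  image-closed : ∀ i {y} → Γ (g i) y ≡ true → ∃ λ j → g j ≡ y
  image-closed i p with Chart.neighbours-exhausted (charts (g i)) (g ∘ ν i) (ν-injective i ∘ g-injective)
                          (λ l → trans (g-induced i (ν i l)) (ν-adjacent i l)) p
  ... | l , e = ν i l , e

  image-reachable : ∀ {u y} → Walk Γ u y → ∀ i → g i ≡ u → ∃ λ j → g j ≡ y
  image-reachable here i e = i , e
  image-reachable (step p w) i refl with image-closed i p
  ... | j , e = image-reachable w j e

  induced-copy⇒≅ : (∀ u y → Walk Γ u y) → Γ ≅ Δ
  induced-copy⇒≅ walks = mk↔ₛ′ g⁻¹ g (λ i → g-injective (g∘g⁻¹ (g i))) g∘g⁻¹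
                       , λ y y′ → trans (sym (g-induced (g⁻¹ y) (g⁻¹ y′))) (cong₂ Γ (g∘g⁻¹ y) (g∘g⁻¹ y′))
    where
      reached : ∀ y → ∃ λ j → g j ≡ y
      reached y = image-reachable (walks (g zero) y) zero refl

      g⁻¹ : V → Fin (suc m)
      g⁻¹ y = proj₁ (reached y)

      g∘g⁻¹ : ∀ y → g (g⁻¹ y) ≡ y
      g∘g⁻¹ y = proj₂ (reached y)

abstract
  P5bar-fifth-vertex : ∀ kv k₂ k₃ k₄ → P5bar kv k₂ ≡ true → P5bar kv k₃ ≡ true → P5bar kv k₄ ≡ true
    → P5bar k₂ k₄ ≡ true → P5bar k₂ k₃ ≡ false → P5bar k₃ k₄ ≡ false
    → ∃ λ k₅ → ¬ k₅ ≡ kv × P5bar k₅ kv ≡ false × P5bar k₅ k₃ ≡ true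
        × ((P5bar k₅ k₂ ≡ true × P5bar k₅ k₄ ≡ false) ⊎ (P5bar k₅ k₂ ≡ false × P5bar k₅ k₄ ≡ true))
        × (∀ k → k ≡ kv ⊎ P5bar kv k ≡ true ⊎ k ≡ k₅)
  P5bar-fifth-vertex = from-yes (all? λ kv → all? λ k₂ → all? λ k₃ → all? λ k₄ →
    P5bar kv k₂ ≟ᵇ true →-dec P5bar kv k₃ ≟ᵇ true →-dec P5bar kv k₄ ≟ᵇ true →-dec
    P5bar k₂ k₄ ≟ᵇ true →-dec P5bar k₂ k₃ ≟ᵇ false →-dec P5bar k₃ k₄ ≟ᵇ false →-dec
    any? λ k₅ → ¬? (k₅ ≟ kv) ×-dec P5bar k₅ kv ≟ᵇ false ×-dec P5bar k₅ k₃ ≟ᵇ true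
      ×-dec ((P5bar k₅ k₂ ≟ᵇ true ×-dec P5bar k₅ k₄ ≟ᵇ false) ⊎-dec (P5bar k₅ k₂ ≟ᵇ false ×-dec P5bar k₅ k₄ ≟ᵇ true))
      ×-dec all? λ k → k ≟ kv ⊎-dec P5bar kv k ≟ᵇ true ⊎-dec k ≟ k₅)

  P5bar-triangle-escape : ∀ k₁ k₂ k₃ → P5bar k₁ k₂ ≡ true → P5bar k₁ k₃ ≡ true → P5bar k₂ k₃ ≡ true
    → ∃ λ k → ¬ k ≡ k₁ × ¬ k ≡ k₂ × ¬ k ≡ k₃ × (P5bar k k₁ ≡ true ⊎ P5bar k k₂ ≡ true ⊎ P5bar k k₃ ≡ true)
  P5bar-triangle-escape = from-yes (all? λ k₁ → all? λ k₂ → all? λ k₃ →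
    P5bar k₁ k₂ ≟ᵇ true →-dec P5bar k₁ k₃ ≟ᵇ true →-dec P5bar k₂ k₃ ≟ᵇ true →-dec
    any? λ k → ¬? (k ≟ k₁) ×-dec ¬? (k ≟ k₂) ×-dec ¬? (k ≟ k₃)
      ×-dec (P5bar k k₁ ≟ᵇ true ⊎-dec P5bar k k₂ ≟ᵇ true ⊎-dec P5bar k k₃ ≟ᵇ true))

  P5bar-pendants-adjacent : ∀ k₁ k₂ k₃ ky kz → P5bar k₁ k₂ ≡ true → P5bar k₁ k₃ ≡ true → P5bar k₂ k₃ ≡ true
    → P5bar ky k₁ ≡ false → P5bar ky k₂ ≡ false → P5bar ky k₃ ≡ true
    → P5bar kz k₁ ≡ false → P5bar kz k₂ ≡ true → P5bar kz k₃ ≡ false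
    → P5bar ky kz ≡ true
  P5bar-pendants-adjacent = from-yes (all? λ k₁ → all? λ k₂ → all? λ k₃ → all? λ ky → all? λ kz →
    P5bar k₁ k₂ ≟ᵇ true →-dec P5bar k₁ k₃ ≟ᵇ true →-dec P5bar k₂ k₃ ≟ᵇ true →-dec
    P5bar ky k₁ ≟ᵇ false →-dec P5bar ky k₂ ≟ᵇ false →-dec P5bar ky k₃ ≟ᵇ true →-dec
    P5bar kz k₁ ≟ᵇ false →-dec P5bar kz k₂ ≟ᵇ true →-dec P5bar kz k₃ ≟ᵇ false →-dec
    P5bar ky kz ≟ᵇ true)

  P5bar-square-closure : ∀ kv kp kq kr kz → P5bar kv kp ≡ true → P5bar kv kq ≡ true → P5bar kp kq ≡ false
    → P5bar kp kr ≡ true → P5bar kr kv ≡ false → P5bar kz kv ≡ false → P5bar kz kp ≡ false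
    → P5bar kr kq ≡ true
  P5bar-square-closure = from-yes (all? λ kv → all? λ kp → all? λ kq → all? λ kr → all? λ kz →
    P5bar kv kp ≟ᵇ true →-dec P5bar kv kq ≟ᵇ true →-dec P5bar kp kq ≟ᵇ false →-dec
    P5bar kp kr ≟ᵇ true →-dec P5bar kr kv ≟ᵇ false →-dec P5bar kz kv ≟ᵇ false →-dec P5bar kz kp ≟ᵇ false →-dec
    P5bar kr kq ≟ᵇ true)

  P5bar-neighbours₁ : ∀ s → P5bar (# 1) s ≡ true → s ≡ # 4 ⊎ s ≡ # 3
  P5bar-neighbours₁ = from-yes (all? λ s → P5bar (# 1) s ≟ᵇ true →-dec (s ≟ # 4 ⊎-dec s ≟ # 3))

  P5bar-neighbours₂ : ∀ s → P5bar (# 2) s ≡ true → s ≡ # 0 ⊎ s ≡ # 4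
  P5bar-neighbours₂ = from-yes (all? λ s → P5bar (# 2) s ≟ᵇ true →-dec (s ≟ # 0 ⊎-dec s ≟ # 4))

  P5bar-neighbours₃ : ∀ s → P5bar (# 3) s ≡ true → s ≡ # 0 ⊎ s ≡ # 1
  P5bar-neighbours₃ = from-yes (all? λ s → P5bar (# 3) s ≟ᵇ true →-dec (s ≟ # 0 ⊎-dec s ≟ # 1))

  avoid-four : ∀ (a b c d : Fin 5) → ∃ λ k → ¬ k ≡ a × ¬ k ≡ b × ¬ k ≡ c × ¬ k ≡ d
  avoid-four = from-yes (all? λ (a : Fin 5) → all? λ b → all? λ c → all? λ d →
    any? λ k → ¬? (k ≟ a) ×-dec ¬? (k ≟ b) ×-dec ¬? (k ≟ c) ×-dec ¬? (k ≟ d))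

C8bar-twin-free : TwinFree C8bar
C8bar-twin-free = from-yes (all? λ i → all? λ j → (all? λ l → C8bar l i ≟ᵇ C8bar l j) →-dec i ≟ j)

C8bar-symmetric : ∀ i j → C8bar i j ≡ C8bar j i
C8bar-symmetric = from-yes (all? λ i → all? λ j → C8bar i j ≟ᵇ C8bar j i)

spoke : Fin 8 → Fin 5 → Fin 8
spoke i l = (toℕ i + toℕ l + 2) mod 8

spoke-adjacent : ∀ i l → C8bar i (spoke i l) ≡ true
spoke-adjacent = from-yes (all? λ i → all? λ l → C8bar i (spoke i l) ≟ᵇ true)

spoke-injective : ∀ i → Injective _≡_ _≡_ (spoke i)
spoke-injective i {l} {l′} = from-yes (all? λ j → all? λ m → all? λ m′ → spoke j m ≟ spoke j m′ →-dec m ≟ m′) i l l′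

data Site : Set where
  rim : Fin 5 → Site
  tip₀ centre tip₄ : Site

label : Site → Fin 8
label (rim i) = i ↑ˡ 3
label tip₀ = # 5
label centre = # 6
label tip₄ = # 7

site : Fin 8 → Site
site i = [ rim , lookup (tip₀ ∷ centre ∷ tip₄ ∷ []) ]′ (splitAt 5 i)

label-site : ∀ i → label (site i) ≡ i
label-site = from-yes (all? λ i → label (site i) ≟ i)

C8bar-rim : ∀ i j → C8bar (label (rim i)) (label (rim j)) ≡ P5bar i j
C8bar-rim = from-yes (all? λ i → all? λ j → C8bar (label (rim i)) (label (rim j)) ≟ᵇ P5bar i j)

C8bar-centre : ∀ i → C8bar (label centre) (label (rim i)) ≡ true
C8bar-centre = from-yes (all? λ i → C8bar (label centre) (label (rim i)) ≟ᵇ true)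

module LocallyP5bar {V : Set} {Γ : Graph V} (simple : IsSimple Γ) (charts : ∀ u → Chart Γ P5bar u) where

  flip : ∀ {a b c} → Γ a b ≡ c → Γ b a ≡ c
  flip {a} {b} h = trans (proj₁ simple b a) h

  contradicts : ∀ {a b} → Γ a b ≡ true → Γ a b ≡ false → ⊥
  contradicts p q with trans (sym p) q
  ... | ()

  record Wing (v u w₂ w₃ w₄ t : V) : Set where
    field
      tip-adjacent : Γ u t ≡ true
      tip-apart : ¬ t ≡ v
      tip-v : Γ t v ≡ false
      tip-w₃ : Γ t w₃ ≡ true
      tip-alternative : (Γ t w₂ ≡ true × Γ t w₄ ≡ false) ⊎ (Γ t w₂ ≡ false × Γ t w₄ ≡ true)
      neighbours : ∀ {y} → Γ u y ≡ true → y ≡ v ⊎ Γ v y ≡ true ⊎ y ≡ t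

    tip-unique : ∀ {y} → Γ u y ≡ true → Γ y v ≡ false → ¬ y ≡ v → y ≡ t
    tip-unique p y-v y≢v with neighbours p
    ... | inj₁ y≡v = contradiction y≡v y≢v
    ... | inj₂ (inj₁ v-y) = ⊥-elim (contradicts (flip v-y) y-v)
    ... | inj₂ (inj₂ y≡t) = y≡t

    tip-w₄ : Γ t w₂ ≡ true → Γ t w₄ ≡ false
    tip-w₄ t-w₂ with tip-alternative
    ... | inj₁ (_ , t-w₄) = t-w₄
    ... | inj₂ (t-w₂′ , _) = ⊥-elim (contradicts t-w₂ t-w₂′)

  open Wing

  tip-w₂-transfer : ∀ {v u w₂ w₃ w₃′ w₄ t t′} → Wing v u w₂ w₃ w₄ t → Wing v w₄ w₂ w₃′ u t′
    → Γ t w₂ ≡ true → Γ t′ w₂ ≡ true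
  tip-w₂-transfer W W′ t-w₂ with tip-alternative W′
  ... | inj₁ (t′-w₂ , _) = t′-w₂
  ... | inj₂ (t′-w₂ , t′-u) with tip-unique W (flip t′-u) (tip-v W′) (tip-apart W′)
  ...   | refl = ⊥-elim (contradicts t-w₂ t′-w₂)

  module _ {u : V} where
    open Chart (charts u)

    wing : ∀ {v w₂ w₃ w₄} → Γ u v ≡ true → Γ u w₂ ≡ true → Γ u w₃ ≡ true → Γ u w₄ ≡ true
      → Γ v w₂ ≡ true → Γ v w₃ ≡ true → Γ v w₄ ≡ true → Γ w₂ w₄ ≡ true → Γ w₂ w₃ ≡ false → Γ w₃ w₄ ≡ false
      → ∃ (Wing v u w₂ w₃ w₄)
    wing u-v u-w₂ u-w₃ u-w₄ v-w₂ v-w₃ v-w₄ w₂-w₄ w₂-w₃ w₃-w₄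
      with covers _ u-v | covers _ u-w₂ | covers _ u-w₃ | covers _ u-w₄
    ... | kv , refl | k₂ , refl | k₃ , refl | k₄ , refl
      with P5bar-fifth-vertex kv k₂ k₃ k₄ (↓ v-w₂) (↓ v-w₃) (↓ v-w₄) (↓ w₂-w₄) (↓ w₂-w₃) (↓ w₃-w₄)
    ... | k₅ , k₅≢kv , k₅-kv , k₅-k₃ , alternative , cover = point k₅ , record
      { tip-adjacent = point-adjacent k₅
      ; tip-apart = k₅≢kv ∘ point-injective
      ; tip-v = ↑ k₅-kv
      ; tip-w₃ = ↑ k₅-k₃
      ; tip-alternative = Sum.map (Product.map ↑_ ↑_) (Product.map ↑_ ↑_) alternative
      ; neighbours = neighbours′
      }
      where
        neighbours′ : ∀ {y} → Γ u y ≡ true → y ≡ point kv ⊎ Γ (point kv) y ≡ true ⊎ y ≡ point k₅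
        neighbours′ p with covers _ p
        ... | k , refl = Sum.map (cong point) (Sum.map ↑_ (cong point)) (cover k)

    triangle-escape : ∀ {a b c} → Γ u a ≡ true → Γ u b ≡ true → Γ u c ≡ true
      → Γ a b ≡ true → Γ a c ≡ true → Γ b c ≡ true
      → ∃ λ y → Γ u y ≡ true × ¬ y ≡ a × ¬ y ≡ b × ¬ y ≡ c × (Γ y a ≡ true ⊎ Γ y b ≡ true ⊎ Γ y c ≡ true)
    triangle-escape u-a u-b u-c a-b a-c b-c with covers _ u-a | covers _ u-b | covers _ u-c
    ... | ka , refl | kb , refl | kc , refl with P5bar-triangle-escape ka kb kc (↓ a-b) (↓ a-c) (↓ b-c)
    ... | k , k≢ka , k≢kb , k≢kc , attached =
      point k , point-adjacent k , k≢ka ∘ point-injective , k≢kb ∘ point-injective , k≢kc ∘ point-injective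
      , Sum.map ↑_ (Sum.map ↑_ ↑_) attached

    pendants-adjacent : ∀ {a b c y z} → Γ u a ≡ true → Γ u b ≡ true → Γ u c ≡ true → Γ u y ≡ true → Γ u z ≡ true
      → Γ a b ≡ true → Γ a c ≡ true → Γ b c ≡ true
      → Γ y a ≡ false → Γ y b ≡ false → Γ y c ≡ true
      → Γ z a ≡ false → Γ z b ≡ true → Γ z c ≡ false
      → Γ y z ≡ true
    pendants-adjacent u-a u-b u-c u-y u-z a-b a-c b-c y-a y-b y-c z-a z-b z-c
      with covers _ u-a | covers _ u-b | covers _ u-c | covers _ u-y | covers _ u-z
    ... | ka , refl | kb , refl | kc , refl | ky , refl | kz , refl =
      ↑ P5bar-pendants-adjacent ka kb kc ky kz (↓ a-b) (↓ a-c) (↓ b-c) (↓ y-a) (↓ y-b) (↓ y-c) (↓ z-a) (↓ z-b) (↓ z-c)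

    square-closure : ∀ {v p q w₂ w₃ w₄ r} → Wing v p w₂ w₃ w₄ r
      → Γ u v ≡ true → Γ u p ≡ true → Γ u q ≡ true → Γ u r ≡ true
      → Γ v p ≡ true → Γ v q ≡ true → Γ p q ≡ false
      → (∀ {y} → Γ u y ≡ true → Γ v y ≡ true → y ≡ p ⊎ y ≡ q)
      → Γ r q ≡ true
    square-closure W u-v u-p u-q u-r v-p v-q p-q common with covers _ u-v | covers _ u-p | covers _ u-q | covers _ u-r
    ... | kv , refl | kp , refl | kq , refl | kr , refl with avoid-four kv kp kq kr
    ... | kz , kz≢kv , kz≢kp , kz≢kq , kz≢kr =
      ↑ P5bar-square-closure kv kp kq kr kz (↓ v-p) (↓ v-q) (↓ p-q) (↓ tip-adjacent W) (↓ tip-v W)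
          (↓ z-v) (↓ z-p)
      where
        z-v : Γ (point kz) (point kv) ≡ false
        z-v = ¬-not λ z-v′ → [ kz≢kp ∘ point-injective , kz≢kq ∘ point-injective ]′ (common (point-adjacent kz) (flip z-v′))

        z-p : Γ (point kz) (point kp) ≡ false
        z-p = ¬-not λ z-p′ → [ kz≢kv ∘ point-injective , [ (λ v-z → contradicts (flip v-z) z-v) , kz≢kr ∘ point-injective ]′ ]′
                               (neighbours W (flip z-p′))

  module Around (v : V) where
    open Chart (charts v) using () renaming (point to x; point-adjacent to v-x; point-pattern to x-x)

    x₀ x₁ x₂ x₃ x₄ : V
    x₀ = x (# 0)
    x₁ = x (# 1)
    x₂ = x (# 2)
    x₃ = x (# 3)
    x₄ = x (# 4)

    x-v : ∀ i → Γ (x i) v ≡ true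
    x-v i = flip (v-x i)

    common-pair : ∀ i {j l} → (∀ s → P5bar i s ≡ true → s ≡ j ⊎ s ≡ l)
      → ∀ {y} → Γ (x i) y ≡ true → Γ v y ≡ true → y ≡ x j ⊎ y ≡ x l
    common-pair i pair x-y v-y with Chart.common-neighbour (charts v) i x-y v-y
    ... | s , refl , i-s = Sum.map (cong x) (cong x) (pair s i-s)

    wing₀ : ∃ (Wing v x₀ x₂ x₃ x₄)
    wing₀ = wing (x-v (# 0)) (x-x (# 0) (# 2)) (x-x (# 0) (# 3)) (x-x (# 0) (# 4))
                 (v-x (# 2)) (v-x (# 3)) (v-x (# 4)) (x-x (# 2) (# 4)) (x-x (# 2) (# 3)) (x-x (# 3) (# 4))

    wing₄ : ∃ (Wing v x₄ x₂ x₁ x₀)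
    wing₄ = wing (x-v (# 4)) (x-x (# 4) (# 2)) (x-x (# 4) (# 1)) (x-x (# 4) (# 0))
                 (v-x (# 2)) (v-x (# 1)) (v-x (# 0)) (x-x (# 2) (# 0)) (x-x (# 2) (# 1)) (x-x (# 1) (# 0))

    t₀ t₄ : V
    t₀ = proj₁ wing₀
    t₄ = proj₁ wing₄

    W₀ : Wing v x₀ x₂ x₃ x₄ t₀
    W₀ = proj₂ wing₀

    W₄ : Wing v x₄ x₂ x₁ x₀ t₄
    W₄ = proj₂ wing₄

    some-tip-x₂ : Γ t₀ x₂ ≡ true ⊎ Γ t₄ x₂ ≡ true
    some-tip-x₂ with triangle-escape (x-v (# 2)) (x-x (# 2) (# 0)) (x-x (# 2) (# 4)) (v-x (# 0)) (v-x (# 4)) (x-x (# 0) (# 4))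
    ... | y , x₂-y , y≢v , y≢x₀ , y≢x₄ , attached =
      [ ⊥-elim ∘ off-v ∘ flip , [ inj₁ ∘ tip-via W₀ ∘ flip , inj₂ ∘ tip-via W₄ ∘ flip ]′ ]′ attached
      where
        off-v : ¬ Γ v y ≡ true
        off-v v-y = [ y≢x₀ , y≢x₄ ]′ (common-pair (# 2) P5bar-neighbours₂ x₂-y v-y)

        tip-via : ∀ {u w₂ w₃ w₄ t} → Wing v u w₂ w₃ w₄ t → Γ u y ≡ true → Γ t x₂ ≡ true
        tip-via W u-y with neighbours W u-y
        ... | inj₁ y≡v = ⊥-elim (y≢v y≡v)
        ... | inj₂ (inj₁ v-y) = ⊥-elim (off-v v-y)
        ... | inj₂ (inj₂ refl) = flip x₂-y

    tips-x₂ : Γ t₀ x₂ ≡ true × Γ t₄ x₂ ≡ true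
    tips-x₂ with some-tip-x₂
    ... | inj₁ t₀-x₂ = t₀-x₂ , tip-w₂-transfer W₀ W₄ t₀-x₂
    ... | inj₂ t₄-x₂ = tip-w₂-transfer W₄ W₀ t₄-x₂ , t₄-x₂

    t₄-t₀ : Γ t₄ t₀ ≡ true
    t₄-t₀ = pendants-adjacent (x-v (# 2)) (x-x (# 2) (# 0)) (x-x (# 2) (# 4)) (flip (proj₂ tips-x₂)) (flip (proj₁ tips-x₂))
              (v-x (# 0)) (v-x (# 4)) (x-x (# 0) (# 4))
              (tip-v W₄) (tip-w₄ W₄ (proj₂ tips-x₂)) (flip (tip-adjacent W₄))
              (tip-v W₀) (flip (tip-adjacent W₀)) (tip-w₄ W₀ (proj₁ tips-x₂))

    t₀-x₁ : Γ t₀ x₁ ≡ true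
    t₀-x₁ = square-closure W₀ (x-v (# 3)) (x-x (# 3) (# 0)) (x-x (# 3) (# 1)) (flip (tip-w₃ W₀))
              (v-x (# 0)) (v-x (# 1)) (x-x (# 0) (# 1))
              (common-pair (# 3) P5bar-neighbours₃)

    t₄-x₃ : Γ t₄ x₃ ≡ true
    t₄-x₃ = square-closure W₄ (x-v (# 1)) (x-x (# 1) (# 4)) (x-x (# 1) (# 3)) (flip (tip-w₃ W₄))
              (v-x (# 4)) (v-x (# 3)) (x-x (# 4) (# 3))
              (common-pair (# 1) P5bar-neighbours₁)

    place : Site → V
    place (rim i) = x i
    place tip₀ = t₀
    place centre = v
    place tip₄ = t₄

    tip₀-rim : ∀ i → Γ t₀ (x i) ≡ C8bar (label tip₀) (label (rim i))
    tip₀-rim zero = flip (tip-adjacent W₀)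
    tip₀-rim (suc zero) = t₀-x₁
    tip₀-rim (suc (suc zero)) = proj₁ tips-x₂
    tip₀-rim (suc (suc (suc zero))) = tip-w₃ W₀
    tip₀-rim (suc (suc (suc (suc zero)))) = tip-w₄ W₀ (proj₁ tips-x₂)

    tip₄-rim : ∀ i → Γ t₄ (x i) ≡ C8bar (label tip₄) (label (rim i))
    tip₄-rim zero = tip-w₄ W₄ (proj₂ tips-x₂)
    tip₄-rim (suc zero) = tip-w₃ W₄
    tip₄-rim (suc (suc zero)) = proj₂ tips-x₂
    tip₄-rim (suc (suc (suc zero))) = t₄-x₃
    tip₄-rim (suc (suc (suc (suc zero)))) = flip (tip-adjacent W₄)

    to-rim : ∀ s i → Γ (place s) (x i) ≡ C8bar (label s) (label (rim i))
    to-rim (rim j) i = trans (x-x j i) (sym (C8bar-rim j i))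
    to-rim tip₀ = tip₀-rim
    to-rim centre i = trans (v-x i) (sym (C8bar-centre i))
    to-rim tip₄ = tip₄-rim

    transpose : ∀ {a b i j} → Γ a b ≡ C8bar i j → Γ b a ≡ C8bar j i
    transpose {i = i} {j} h = trans (flip h) (C8bar-symmetric i j)

    adjacency : ∀ s s′ → Γ (place s) (place s′) ≡ C8bar (label s) (label s′)
    adjacency s (rim i) = to-rim s i
    adjacency (rim i) s = transpose {i = label s} (to-rim s i)
    adjacency tip₀ tip₀ = proj₂ simple t₀
    adjacency tip₀ centre = tip-v W₀
    adjacency tip₀ tip₄ = flip t₄-t₀
    adjacency centre tip₀ = flip (tip-v W₀)
    adjacency centre centre = proj₂ simple v
    adjacency centre tip₄ = flip (tip-v W₄)
    adjacency tip₄ tip₀ = t₄-t₀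
    adjacency tip₄ centre = tip-v W₄
    adjacency tip₄ tip₄ = proj₂ simple t₄

    embedding : Fin 8 → V
    embedding = place ∘ site

    embedding-induced : ∀ i j → Γ (embedding i) (embedding j) ≡ C8bar i j
    embedding-induced i j = trans (adjacency (site i) (site j)) (cong₂ C8bar (label-site i) (label-site j))

lemma5p11 : (n : ℕ) (Γ : Graph (Fin n)) → IsSimple Γ → Connected Γ → VertexTransitive Γ
    → (∀ (v : Fin n) → LocalGraph Γ v ≅ P5bar) → Γ ≅ C8bar
lemma5p11 n Γ simple (v , walks) _ locally =
  induced-copy⇒≅ charts C8bar-twin-free spoke spoke-adjacent spoke-injective embedding embedding-induced walks
  where
    charts : ∀ u → Chart Γ P5bar u
    charts u = chart (locally u)

    open LocallyP5bar simple charts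
    open Around v
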